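{- For every $\epsilon>0$ there is $\epsilon'>0$ depending only on $\epsilon$ such that every $f:\{0,1\}^n\to\{ -1,1\}$ with $\|f\|_{U_3}\ge\epsilon$ satisfies $$\mathbb{E}_{x,y}\sum_{\alpha,\beta\in\{0,1\}^n}\widehat{f_x}^{\,2}(\alpha)\,\widehat{f_y}^{\,2}(\beta)\,\widehat{f_{x+y}}^{\,2}(\alpha+\beta)\ge\epsilon'.$$
   Context: Addition is in $\mathbb{F}_2^n$; $f_y(x)=f(x)f(x+y)$; $\hat h(\alpha)=\mathbb{E}_x h(x)(-1)^{\langle\alpha,x\rangle}$; $x,y$ independent uniform; $\|f\|_{U_3}=\big[\mathbb{E}_{x,y_1,y_2,y_3}\prod_{S\subseteq\{1,2,3\}}f(x+\sum_{i\in S}y_i)\big]^{1/8}$.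
   Formalization: The parameter ε ranges over the positive rationals, and the constant ε′ is taken in the rationals. -}

module Defs where

open import Data.Bool using (Bool; true; false; _xor_; _∧_; if_then_else_)
open import Data.Nat using (ℕ; zero; suc)
open import Data.Vec using (Vec; []; _∷_; zipWith)
open import Data.List using (List; []; _∷_; map; concatMap; foldr)
open import Relation.Binary.PropositionalEquality using (_≡_)
open import Data.Sum using (_⊎_)
open import Data.Rational using (ℚ; 0ℚ; 1ℚ; ½; _+_; _*_; -_)

𝔽₂^ : ℕ → Set
𝔽₂^ n = Vec Bool n

_⊕_ : ∀ {n} → 𝔽₂^ n → 𝔽₂^ n → 𝔽₂^ n
_⊕_ = zipWith _xor_

allVecs : (n : ℕ) → List (𝔽₂^ n)
allVecs zero = [] ∷ []
allVecs (suc n) = concatMap (λ v → (false ∷ v) ∷ (true ∷ v) ∷ []) (allVecs n)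

sumℚ : List ℚ → ℚ
sumℚ = foldr _+_ 0ℚ

inv2^ : ℕ → ℚ
inv2^ zero = 1ℚ
inv2^ (suc n) = ½ * inv2^ n

Σ𝔽 : (n : ℕ) → (𝔽₂^ n → ℚ) → ℚ
Σ𝔽 n h = sumℚ (map h (allVecs n))

𝔼 : (n : ℕ) → (𝔽₂^ n → ℚ) → ℚ
𝔼 n h = inv2^ n * Σ𝔽 n h

dot : ∀ {n} → 𝔽₂^ n → 𝔽₂^ n → Bool
dot [] [] = false
dot (a ∷ α) (b ∷ x) = (a ∧ b) xor dot α x

χ : ∀ {n} → 𝔽₂^ n → 𝔽₂^ n → ℚ
χ α x = if dot α x then - 1ℚ else 1ℚ

hat : (n : ℕ) → (𝔽₂^ n → ℚ) → 𝔽₂^ n → ℚ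
hat n h α = 𝔼 n (λ x → h x * χ α x)

deriv : ∀ {n} → (𝔽₂^ n → ℚ) → 𝔽₂^ n → 𝔽₂^ n → ℚ
deriv f y x = f x * f (x ⊕ y)

sq : ℚ → ℚ
sq a = a * a

pow : ℚ → ℕ → ℚ
pow a zero = 1ℚ
pow a (suc k) = a * pow a k

U3⁸ : (n : ℕ) → (𝔽₂^ n → ℚ) → ℚ
U3⁸ n f = 𝔼 n λ x → 𝔼 n λ y₁ → 𝔼 n λ y₂ → 𝔼 n λ y₃ →
  f x * f (x ⊕ y₁) * f (x ⊕ y₂) * f (x ⊕ y₃)
  * f ((x ⊕ y₁) ⊕ y₂) * f ((x ⊕ y₁) ⊕ y₃) * f ((x ⊕ y₂) ⊕ y₃)
  * f (((x ⊕ y₁) ⊕ y₂) ⊕ y₃)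

Q : (n : ℕ) → (𝔽₂^ n → ℚ) → ℚ
Q n f = 𝔼 n λ x → 𝔼 n λ y → Σ𝔽 n λ α → Σ𝔽 n λ β →
  sq (hat n (deriv f x) α) * sq (hat n (deriv f y) β)
  * sq (hat n (deriv f (x ⊕ y)) (α ⊕ β))

IsBoolean : ∀ {n} → (𝔽₂^ n → ℚ) → Set
IsBoolean {n} f = ∀ (x : 𝔽₂^ n) → f x ≡ 1ℚ ⊎ f x ≡ - 1ℚ

{-# OPTIONS --safe #-}
-- Write G_x = f_x ⋆ f_x for the autocorrelation of the derivative f_x. Since ĝ² is the
-- Fourier transform of g ⋆ g, Fourier inversion turns Q into E_{x,y,z} G_x(z) G_y(z) G_{x+y}(z),
-- and the symmetry G_x(z) = G_z(x) rewrites it as E_z E_{x,y} G_z(x) G_z(y) G_z(x+y). On the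
-- other side ‖f‖_{U3}^8 = E_z E_x G_z(x)². For g = ±1 with G = g ⋆ g one has
-- E_x G(x)² = E_w g(w) (G ⋆ g)(w), so Cauchy–Schwarz against |g| = 1 bounds its square by
-- E_w (G ⋆ g)(w)² = E_{x,y} G(x) G(y) G(x+y). Applied to g = f_z, averaged over z and combined
-- with one more Cauchy–Schwarz this gives ‖f‖_{U3}^16 ≤ Q, so ε′ = ε^16 works.
module Submission where

open import Algebra.Bundles using (CommutativeRing; CommutativeMonoid)
import Algebra.Properties.CommutativeSemigroup as CommutativeSemigroupProperties
open import Data.Bool using (Bool; true; false; _xor_; _∧_; not; if_then_else_)
open import Data.Bool.Properties
  using ( xor-comm; xor-assoc; xor-identityʳ; xor-same; ∧-distribˡ-xor; ∧-distribʳ-xor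
        ; xor-∧-commutativeRing )
open import Data.List using (List; []; _∷_; map; concatMap)
open import Data.List.Properties using (map-cong)
open import Data.Nat using (ℕ; zero; suc)
open import Data.Product using (∃; _×_; _,_)
open import Data.Rational
  using (ℚ; 0ℚ; 1ℚ; ½; _+_; _*_; -_; _-_; _<_; _≤_; positive; nonNegative; nonPositive)
open import Data.Rational.Properties
open import Data.Rational.Solver using (module +-*-Solver)
open import Data.Sum using (inj₁; inj₂)
open import Data.Vec using ([]; _∷_; replicate)
open import Data.Vec.Properties using (zipWith-comm; zipWith-assoc; zipWith-identityʳ)
open import Relation.Binary.PropositionalEquality

open import Defs

open +-*-Solver using (solve; _:+_; _:*_; _:-_; :-_; _:=_; con)
open CommutativeSemigroupProperties (CommutativeRing.+-commutativeSemigroup xor-∧-commutativeRing)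
  using () renaming (interchange to xor-interchange)
open CommutativeSemigroupProperties (CommutativeMonoid.commutativeSemigroup +-0-commutativeMonoid)
  using () renaming (interchange to +-interchange)

private variable
  X Y : Set
  n : ℕ

-- Sums and averages

sumℚ-map-cong : (l : List X) {h k : X → ℚ} → (∀ x → h x ≡ k x) →
  sumℚ (map h l) ≡ sumℚ (map k l)
sumℚ-map-cong l h≗k = cong sumℚ (map-cong h≗k l)

sumℚ-map-0 : (l : List X) → sumℚ (map (λ _ → 0ℚ) l) ≡ 0ℚ
sumℚ-map-0 []      = refl
sumℚ-map-0 (x ∷ l) = trans (+-identityˡ _) (sumℚ-map-0 l)

sumℚ-map-+ : (l : List X) (h k : X → ℚ) →
  sumℚ (map (λ x → h x + k x) l) ≡ sumℚ (map h l) + sumℚ (map k l)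
sumℚ-map-+ []      h k = sym (+-identityʳ 0ℚ)
sumℚ-map-+ (x ∷ l) h k =
  trans (cong (h x + k x +_) (sumℚ-map-+ l h k)) (+-interchange (h x) (k x) _ _)

sumℚ-map-*ˡ : (l : List X) (c : ℚ) (h : X → ℚ) →
  sumℚ (map (λ x → c * h x) l) ≡ c * sumℚ (map h l)
sumℚ-map-*ˡ []      c h = sym (*-zeroʳ c)
sumℚ-map-*ˡ (x ∷ l) c h =
  trans (cong (c * h x +_) (sumℚ-map-*ˡ l c h)) (sym (*-distribˡ-+ c (h x) _))

sumℚ-map-swap : (l : List X) (m : List Y) (h : X → Y → ℚ) →
  sumℚ (map (λ x → sumℚ (map (h x) m)) l) ≡ sumℚ (map (λ y → sumℚ (map (λ x → h x y) l)) m)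
sumℚ-map-swap []      m h = sym (sumℚ-map-0 m)
sumℚ-map-swap (x ∷ l) m h =
  trans (cong (sumℚ (map (h x) m) +_) (sumℚ-map-swap l m h)) (sym (sumℚ-map-+ m (h x) _))

sumℚ-map-mono : (l : List X) {h k : X → ℚ} → (∀ x → h x ≤ k x) →
  sumℚ (map h l) ≤ sumℚ (map k l)
sumℚ-map-mono []      h≤k = ≤-refl
sumℚ-map-mono (x ∷ l) h≤k = +-mono-≤ (h≤k x) (sumℚ-map-mono l h≤k)

Σ𝔽-cong : (n : ℕ) {h k : 𝔽₂^ n → ℚ} → (∀ x → h x ≡ k x) → Σ𝔽 n h ≡ Σ𝔽 n k
Σ𝔽-cong n = sumℚ-map-cong (allVecs n)

Σ𝔽-*ˡ : (n : ℕ) (c : ℚ) (h : 𝔽₂^ n → ℚ) → Σ𝔽 n (λ x → c * h x) ≡ c * Σ𝔽 n h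
Σ𝔽-*ˡ n = sumℚ-map-*ˡ (allVecs n)

Σ𝔽-*ʳ : (n : ℕ) (c : ℚ) (h : 𝔽₂^ n → ℚ) → Σ𝔽 n (λ x → h x * c) ≡ Σ𝔽 n h * c
Σ𝔽-*ʳ n c h = trans (Σ𝔽-cong n (λ x → *-comm (h x) c)) (trans (Σ𝔽-*ˡ n c h) (*-comm c _))

Σ𝔽-suc : (n : ℕ) (h : 𝔽₂^ (suc n) → ℚ) →
  Σ𝔽 (suc n) h ≡ Σ𝔽 n (λ v → h (false ∷ v) + h (true ∷ v))
Σ𝔽-suc n h = split (allVecs n)
  where
  split : (l : List (𝔽₂^ n)) →
    sumℚ (map h (concatMap (λ v → (false ∷ v) ∷ (true ∷ v) ∷ []) l))
    ≡ sumℚ (map (λ v → h (false ∷ v) + h (true ∷ v)) l)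
  split []      = refl
  split (v ∷ l) = trans (cong (λ s → h (false ∷ v) + (h (true ∷ v) + s)) (split l))
                        (sym (+-assoc (h (false ∷ v)) (h (true ∷ v)) _))

inv2^-nonNeg : (n : ℕ) → 0ℚ ≤ inv2^ n
inv2^-nonNeg zero    = <⇒≤ (positive⁻¹ 1ℚ)
inv2^-nonNeg (suc n) =
  nonNegative⁻¹ _ {{nonNeg*nonNeg⇒nonNeg ½ (inv2^ n) {{nonNegative (inv2^-nonNeg n)}}}}

𝔼-cong : (n : ℕ) {h k : 𝔽₂^ n → ℚ} → (∀ x → h x ≡ k x) → 𝔼 n h ≡ 𝔼 n k
𝔼-cong n h≗k = cong (inv2^ n *_) (Σ𝔽-cong n h≗k)

𝔼-+ : (n : ℕ) (h k : 𝔽₂^ n → ℚ) → 𝔼 n (λ x → h x + k x) ≡ 𝔼 n h + 𝔼 n k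
𝔼-+ n h k = trans (cong (inv2^ n *_) (sumℚ-map-+ (allVecs n) h k)) (*-distribˡ-+ (inv2^ n) _ _)

𝔼-*ˡ : (n : ℕ) (c : ℚ) (h : 𝔽₂^ n → ℚ) → 𝔼 n (λ x → c * h x) ≡ c * 𝔼 n h
𝔼-*ˡ n c h = begin
  inv2^ n * Σ𝔽 n (λ x → c * h x)
    ≡⟨ cong (inv2^ n *_) (Σ𝔽-*ˡ n c h) ⟩
  inv2^ n * (c * Σ𝔽 n h)
    ≡⟨ solve 3 (λ a c s → a :* (c :* s) := c :* (a :* s)) refl (inv2^ n) c _ ⟩
  c * (inv2^ n * Σ𝔽 n h) ∎
  where open ≡-Reasoning

𝔼-*ʳ : (n : ℕ) (c : ℚ) (h : 𝔽₂^ n → ℚ) → 𝔼 n (λ x → h x * c) ≡ 𝔼 n h * c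
𝔼-*ʳ n c h = trans (𝔼-cong n (λ x → *-comm (h x) c)) (trans (𝔼-*ˡ n c h) (*-comm c _))

𝔼-mono : (n : ℕ) {h k : 𝔽₂^ n → ℚ} → (∀ x → h x ≤ k x) → 𝔼 n h ≤ 𝔼 n k
𝔼-mono n h≤k =
  *-monoˡ-≤-nonNeg (inv2^ n) {{nonNegative (inv2^-nonNeg n)}} (sumℚ-map-mono (allVecs n) h≤k)

Σ𝔽-𝔼-swap : (n : ℕ) (h : 𝔽₂^ n → 𝔽₂^ n → ℚ) →
  Σ𝔽 n (λ x → 𝔼 n (λ y → h x y)) ≡ 𝔼 n (λ y → Σ𝔽 n (λ x → h x y))
Σ𝔽-𝔼-swap n h =
  trans (Σ𝔽-*ˡ n (inv2^ n) _) (cong (inv2^ n *_) (sumℚ-map-swap (allVecs n) (allVecs n) h))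

𝔼-swap : (n : ℕ) (h : 𝔽₂^ n → 𝔽₂^ n → ℚ) →
  𝔼 n (λ x → 𝔼 n (λ y → h x y)) ≡ 𝔼 n (λ y → 𝔼 n (λ x → h x y))
𝔼-swap n h = cong (inv2^ n *_) (trans (Σ𝔽-𝔼-swap n h) (sym (Σ𝔽-*ˡ n (inv2^ n) _)))

𝔼-suc : (n : ℕ) (h : 𝔽₂^ (suc n) → ℚ) →
  𝔼 (suc n) h ≡ 𝔼 n (λ v → ½ * (h (false ∷ v) + h (true ∷ v)))
𝔼-suc n h = begin
  ½ * inv2^ n * Σ𝔽 (suc n) h
    ≡⟨ cong (½ * inv2^ n *_) (Σ𝔽-suc n h) ⟩
  ½ * inv2^ n * Σ𝔽 n h₀₁
    ≡⟨ solve 3 (λ a b s → a :* b :* s := b :* (a :* s)) refl ½ (inv2^ n) _ ⟩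
  inv2^ n * (½ * Σ𝔽 n h₀₁)
    ≡⟨ cong (inv2^ n *_) (sym (Σ𝔽-*ˡ n ½ h₀₁)) ⟩
  inv2^ n * Σ𝔽 n (λ v → ½ * h₀₁ v) ∎
  where
  open ≡-Reasoning
  h₀₁ : 𝔽₂^ n → ℚ
  h₀₁ v = h (false ∷ v) + h (true ∷ v)

𝔼-const : (n : ℕ) (c : ℚ) → 𝔼 n (λ _ → c) ≡ c
𝔼-const zero    c = solve 1 (λ c → con 1ℚ :* (c :+ con 0ℚ) := c) refl c
𝔼-const (suc n) c = begin
  𝔼 (suc n) (λ _ → c)      ≡⟨ 𝔼-suc n (λ _ → c) ⟩
  𝔼 n (λ _ → ½ * (c + c))  ≡⟨ 𝔼-cong n (λ _ → solve 1 (λ c → con ½ :* (c :+ c) := c) refl c) ⟩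
  𝔼 n (λ _ → c)            ≡⟨ 𝔼-const n c ⟩
  c                        ∎
  where open ≡-Reasoning

𝔼-nonNeg : (n : ℕ) {h : 𝔽₂^ n → ℚ} → (∀ x → 0ℚ ≤ h x) → 0ℚ ≤ 𝔼 n h
𝔼-nonNeg n {h} 0≤h = subst (_≤ 𝔼 n h) (𝔼-const n 0ℚ) (𝔼-mono n 0≤h)

𝔼-translate : (n : ℕ) (h : 𝔽₂^ n → ℚ) (a : 𝔽₂^ n) → 𝔼 n (λ x → h (a ⊕ x)) ≡ 𝔼 n h
𝔼-translate zero    h []      = refl
𝔼-translate (suc n) h (b ∷ a) = begin
  𝔼 (suc n) (λ x → h ((b ∷ a) ⊕ x))
    ≡⟨ 𝔼-suc n _ ⟩
  𝔼 n (λ v → ½ * h₀₁ b (a ⊕ v))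
    ≡⟨ 𝔼-cong n (λ v → cong (½ *_) (h₀₁-flip b (a ⊕ v))) ⟩
  𝔼 n (λ v → ½ * h₀₁ false (a ⊕ v))
    ≡⟨ 𝔼-translate n (λ v → ½ * h₀₁ false v) a ⟩
  𝔼 n (λ v → ½ * h₀₁ false v)
    ≡⟨ sym (𝔼-suc n h) ⟩
  𝔼 (suc n) h ∎
  where
  open ≡-Reasoning
  h₀₁ : Bool → 𝔽₂^ n → ℚ
  h₀₁ b v = h ((b xor false) ∷ v) + h ((b xor true) ∷ v)
  h₀₁-flip : ∀ b v → h₀₁ b v ≡ h₀₁ false v
  h₀₁-flip false v = refl
  h₀₁-flip true  v = +-comm (h (true ∷ v)) (h (false ∷ v))

-- The group 𝔽₂ⁿ and its characters

𝟎 : 𝔽₂^ n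
𝟎 = replicate _ false

⊕-comm : (x y : 𝔽₂^ n) → x ⊕ y ≡ y ⊕ x
⊕-comm = zipWith-comm xor-comm

⊕-assoc : (x y z : 𝔽₂^ n) → (x ⊕ y) ⊕ z ≡ x ⊕ (y ⊕ z)
⊕-assoc = zipWith-assoc xor-assoc

⊕-identityʳ : (x : 𝔽₂^ n) → x ⊕ 𝟎 ≡ x
⊕-identityʳ = zipWith-identityʳ xor-identityʳ

⊕-self : (x : 𝔽₂^ n) → x ⊕ x ≡ 𝟎
⊕-self []      = refl
⊕-self (b ∷ x) = cong₂ _∷_ (xor-same b) (⊕-self x)

⊕-cancelˡ : (a x : 𝔽₂^ n) → a ⊕ (a ⊕ x) ≡ x
⊕-cancelˡ a x = begin
  a ⊕ (a ⊕ x)  ≡⟨ sym (⊕-assoc a a x) ⟩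
  (a ⊕ a) ⊕ x  ≡⟨ cong (_⊕ x) (⊕-self a) ⟩
  𝟎 ⊕ x        ≡⟨ ⊕-comm 𝟎 x ⟩
  x ⊕ 𝟎        ≡⟨ ⊕-identityʳ x ⟩
  x            ∎
  where open ≡-Reasoning

⊕-swapʳ : (x a b : 𝔽₂^ n) → (x ⊕ a) ⊕ b ≡ (x ⊕ b) ⊕ a
⊕-swapʳ x a b = trans (⊕-assoc x a b) (trans (cong (x ⊕_) (⊕-comm a b)) (sym (⊕-assoc x b a)))

sign : Bool → ℚ
sign b = if b then - 1ℚ else 1ℚ

sign-xor : ∀ a b → sign (a xor b) ≡ sign a * sign b
sign-xor false false = refl
sign-xor false true  = refl
sign-xor true  false = refl
sign-xor true  true  = refl

sign-not : ∀ a → sign (not a) ≡ - sign a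
sign-not false = refl
sign-not true  = refl

dot-⊕ʳ : (α x y : 𝔽₂^ n) → dot α (x ⊕ y) ≡ dot α x xor dot α y
dot-⊕ʳ []      []      []      = refl
dot-⊕ʳ (a ∷ α) (b ∷ x) (c ∷ y) =
  trans (cong₂ _xor_ (∧-distribˡ-xor a b c) (dot-⊕ʳ α x y))
        (xor-interchange (a ∧ b) (a ∧ c) (dot α x) (dot α y))

dot-⊕ˡ : (α β x : 𝔽₂^ n) → dot (α ⊕ β) x ≡ dot α x xor dot β x
dot-⊕ˡ []      []      []      = refl
dot-⊕ˡ (a ∷ α) (b ∷ β) (c ∷ x) =
  trans (cong₂ _xor_ (∧-distribʳ-xor c a b) (dot-⊕ˡ α β x))
        (xor-interchange (a ∧ c) (b ∧ c) (dot α x) (dot β x))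

χ-⊕ʳ : (α x y : 𝔽₂^ n) → χ α (x ⊕ y) ≡ χ α x * χ α y
χ-⊕ʳ α x y = trans (cong sign (dot-⊕ʳ α x y)) (sign-xor (dot α x) (dot α y))

χ-⊕ˡ : (α β x : 𝔽₂^ n) → χ (α ⊕ β) x ≡ χ α x * χ β x
χ-⊕ˡ α β x = trans (cong sign (dot-⊕ˡ α β x)) (sign-xor (dot α x) (dot β x))

-- Fourier analysis and correlations

Σχ-sifting : (n : ℕ) (g : 𝔽₂^ n → ℚ) → 𝔼 n (λ x → g x * Σ𝔽 n (λ α → χ α x)) ≡ g 𝟎
Σχ-sifting zero    g =
  solve 1 (λ a → con 1ℚ :* (a :* (con 1ℚ :+ con 0ℚ) :+ con 0ℚ) := a) refl (g [])
Σχ-sifting (suc n) g = begin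
  𝔼 (suc n) (λ x → g x * Σ𝔽 (suc n) (λ α → χ α x))
    ≡⟨ 𝔼-suc n _ ⟩
  𝔼 n (λ x → ½ * (g (false ∷ x) * Σ𝔽 (suc n) (λ α → χ α (false ∷ x))
                 + g (true ∷ x) * Σ𝔽 (suc n) (λ α → χ α (true ∷ x))))
    ≡⟨ 𝔼-cong n (λ x → cong₂ (λ s t → ½ * (g (false ∷ x) * s + g (true ∷ x) * t))
                             (Σχ-false x) (Σχ-true x)) ⟩
  𝔼 n (λ x → ½ * (g (false ∷ x) * (Σχ x + Σχ x) + g (true ∷ x) * 0ℚ))
    ≡⟨ 𝔼-cong n (λ x → solve 3 (λ a b s → con ½ :* (a :* (s :+ s) :+ b :* con 0ℚ) := a :* s)
                               refl (g (false ∷ x)) (g (true ∷ x)) (Σχ x)) ⟩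
  𝔼 n (λ x → g (false ∷ x) * Σχ x)
    ≡⟨ Σχ-sifting n (λ x → g (false ∷ x)) ⟩
  g 𝟎 ∎
  where
  open ≡-Reasoning
  Σχ : 𝔽₂^ n → ℚ
  Σχ x = Σ𝔽 n (λ α → χ α x)
  Σχ-false : ∀ x → Σ𝔽 (suc n) (λ α → χ α (false ∷ x)) ≡ Σχ x + Σχ x
  Σχ-false x = trans (Σ𝔽-suc n _) (sumℚ-map-+ (allVecs n) (λ α → χ α x) (λ α → χ α x))
  Σχ-true : ∀ x → Σ𝔽 (suc n) (λ α → χ α (true ∷ x)) ≡ 0ℚ
  Σχ-true x = begin
    Σ𝔽 (suc n) (λ α → χ α (true ∷ x))
      ≡⟨ Σ𝔽-suc n _ ⟩
    Σ𝔽 n (λ α → χ α x + sign (not (dot α x)))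
      ≡⟨ Σ𝔽-cong n (λ α → cong (χ α x +_) (sign-not (dot α x))) ⟩
    Σ𝔽 n (λ α → χ α x + - χ α x)
      ≡⟨ Σ𝔽-cong n (λ α → +-inverseʳ (χ α x)) ⟩
    Σ𝔽 n (λ _ → 0ℚ)
      ≡⟨ sumℚ-map-0 (allVecs n) ⟩
    0ℚ ∎

fourier-inversion : (n : ℕ) (h : 𝔽₂^ n → ℚ) (z : 𝔽₂^ n) →
  Σ𝔽 n (λ α → hat n h α * χ α z) ≡ h z
fourier-inversion n h z = begin
  Σ𝔽 n (λ α → hat n h α * χ α z)
    ≡⟨ Σ𝔽-cong n (λ α → sym (𝔼-*ʳ n (χ α z) _)) ⟩
  Σ𝔽 n (λ α → 𝔼 n (λ x → h x * χ α x * χ α z))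
    ≡⟨ Σ𝔽-𝔼-swap n _ ⟩
  𝔼 n (λ x → Σ𝔽 n (λ α → h x * χ α x * χ α z))
    ≡⟨ 𝔼-cong n (λ x → trans (Σ𝔽-cong n (λ α → character-product x α)) (Σ𝔽-*ˡ n (h x) _)) ⟩
  𝔼 n (λ x → h x * Σ𝔽 n (λ α → χ α (z ⊕ x)))
    ≡⟨ sym (𝔼-translate n _ z) ⟩
  𝔼 n (λ x → h (z ⊕ x) * Σ𝔽 n (λ α → χ α (z ⊕ (z ⊕ x))))
    ≡⟨ 𝔼-cong n (λ x → cong (λ y → h (z ⊕ x) * Σ𝔽 n (λ α → χ α y)) (⊕-cancelˡ z x)) ⟩
  𝔼 n (λ x → h (z ⊕ x) * Σ𝔽 n (λ α → χ α x))
    ≡⟨ Σχ-sifting n (λ x → h (z ⊕ x)) ⟩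
  h (z ⊕ 𝟎)
    ≡⟨ cong h (⊕-identityʳ z) ⟩
  h z ∎
  where
  open ≡-Reasoning
  character-product : ∀ x α → h x * χ α x * χ α z ≡ h x * χ α (z ⊕ x)
  character-product x α = trans (*-assoc (h x) _ _)
    (cong (h x *_) (trans (*-comm (χ α x) (χ α z)) (sym (χ-⊕ʳ α z x))))

fourier-triple-product : (n : ℕ) (A B C : 𝔽₂^ n → ℚ) →
  Σ𝔽 n (λ α → Σ𝔽 n (λ β → hat n A α * hat n B β * hat n C (α ⊕ β)))
  ≡ 𝔼 n (λ z → A z * B z * C z)
fourier-triple-product n A B C = begin
  Σ𝔽 n (λ α → Σ𝔽 n (λ β → hat n A α * hat n B β * hat n C (α ⊕ β)))
    ≡⟨ Σ𝔽-cong n (λ α → Σ𝔽-cong n (λ β → expand α β)) ⟩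
  Σ𝔽 n (λ α → Σ𝔽 n (λ β → 𝔼 n (λ z → a α z * (b β z * C z))))
    ≡⟨ Σ𝔽-cong n (λ α → Σ𝔽-𝔼-swap n _) ⟩
  Σ𝔽 n (λ α → 𝔼 n (λ z → Σ𝔽 n (λ β → a α z * (b β z * C z))))
    ≡⟨ Σ𝔽-𝔼-swap n _ ⟩
  𝔼 n (λ z → Σ𝔽 n (λ α → Σ𝔽 n (λ β → a α z * (b β z * C z))))
    ≡⟨ 𝔼-cong n (λ z → Σ𝔽-cong n (λ α →
         trans (Σ𝔽-*ˡ n (a α z) _) (cong (a α z *_) (Σ𝔽-*ʳ n (C z) (λ β → b β z))))) ⟩
  𝔼 n (λ z → Σ𝔽 n (λ α → a α z * (Σ𝔽 n (λ β → b β z) * C z)))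
    ≡⟨ 𝔼-cong n (λ z → Σ𝔽-*ʳ n _ (λ α → a α z)) ⟩
  𝔼 n (λ z → Σ𝔽 n (λ α → a α z) * (Σ𝔽 n (λ β → b β z) * C z))
    ≡⟨ 𝔼-cong n (λ z → cong₂ (λ p q → p * (q * C z))
                             (fourier-inversion n A z) (fourier-inversion n B z)) ⟩
  𝔼 n (λ z → A z * (B z * C z))
    ≡⟨ 𝔼-cong n (λ z → sym (*-assoc (A z) (B z) (C z))) ⟩
  𝔼 n (λ z → A z * B z * C z) ∎
  where
  open ≡-Reasoning
  a b : 𝔽₂^ n → 𝔽₂^ n → ℚ
  a α z = hat n A α * χ α z
  b β z = hat n B β * χ β z
  expand : ∀ α β →
    hat n A α * hat n B β * hat n C (α ⊕ β) ≡ 𝔼 n (λ z → a α z * (b β z * C z))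
  expand α β = begin
    hat n A α * hat n B β * 𝔼 n (λ z → C z * χ (α ⊕ β) z)
      ≡⟨ sym (𝔼-*ˡ n (hat n A α * hat n B β) _) ⟩
    𝔼 n (λ z → hat n A α * hat n B β * (C z * χ (α ⊕ β) z))
      ≡⟨ 𝔼-cong n (λ z → trans (cong (λ t → hat n A α * hat n B β * (C z * t)) (χ-⊕ˡ α β z))
           (solve 5 (λ p q c x y → p :* q :* (c :* (x :* y)) := p :* x :* (q :* y :* c)) refl
              (hat n A α) (hat n B β) (C z) (χ α z) (χ β z))) ⟩
    𝔼 n (λ z → a α z * (b β z * C z)) ∎

_⋆_ : (A B : 𝔽₂^ n → ℚ) → 𝔽₂^ n → ℚ
_⋆_ {n} A B x = 𝔼 n (λ w → A w * B (w ⊕ x))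

hat-⋆ : (n : ℕ) (A B : 𝔽₂^ n → ℚ) (α : 𝔽₂^ n) → hat n (A ⋆ B) α ≡ hat n A α * hat n B α
hat-⋆ n A B α = begin
  𝔼 n (λ x → (A ⋆ B) x * χ α x)
    ≡⟨ 𝔼-cong n (λ x → sym (𝔼-*ʳ n (χ α x) _)) ⟩
  𝔼 n (λ x → 𝔼 n (λ w → A w * B (w ⊕ x) * χ α x))
    ≡⟨ 𝔼-swap n _ ⟩
  𝔼 n (λ w → 𝔼 n (λ x → A w * B (w ⊕ x) * χ α x))
    ≡⟨ 𝔼-cong n (λ w → trans (𝔼-cong n (λ x → *-assoc (A w) _ _)) (𝔼-*ˡ n (A w) _)) ⟩
  𝔼 n (λ w → A w * 𝔼 n (λ x → B (w ⊕ x) * χ α x))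
    ≡⟨ 𝔼-cong n (λ w → cong (A w *_) (shift w)) ⟩
  𝔼 n (λ w → A w * (χ α w * hat n B α))
    ≡⟨ 𝔼-cong n (λ w → sym (*-assoc (A w) (χ α w) _)) ⟩
  𝔼 n (λ w → A w * χ α w * hat n B α)
    ≡⟨ 𝔼-*ʳ n _ _ ⟩
  hat n A α * hat n B α ∎
  where
  open ≡-Reasoning
  shift : ∀ w → 𝔼 n (λ x → B (w ⊕ x) * χ α x) ≡ χ α w * hat n B α
  shift w = begin
    𝔼 n (λ x → B (w ⊕ x) * χ α x)
      ≡⟨ sym (𝔼-translate n _ w) ⟩
    𝔼 n (λ u → B (w ⊕ (w ⊕ u)) * χ α (w ⊕ u))
      ≡⟨ 𝔼-cong n (λ u → cong₂ (λ v c → B v * c) (⊕-cancelˡ w u) (χ-⊕ʳ α w u)) ⟩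
    𝔼 n (λ u → B u * (χ α w * χ α u))
      ≡⟨ 𝔼-cong n (λ u → solve 3 (λ b x y → b :* (x :* y) := x :* (b :* y))
                                 refl (B u) (χ α w) (χ α u)) ⟩
    𝔼 n (λ u → χ α w * (B u * χ α u))
      ≡⟨ 𝔼-*ˡ n (χ α w) _ ⟩
    χ α w * hat n B α ∎

𝔼-⋆-adjoint : (n : ℕ) (A B C : 𝔽₂^ n → ℚ) →
  𝔼 n (λ x → C x * (A ⋆ B) x) ≡ 𝔼 n (λ w → A w * (C ⋆ B) w)
𝔼-⋆-adjoint n A B C = begin
  𝔼 n (λ x → C x * 𝔼 n (λ w → A w * B (w ⊕ x)))
    ≡⟨ 𝔼-cong n (λ x → sym (𝔼-*ˡ n (C x) _)) ⟩
  𝔼 n (λ x → 𝔼 n (λ w → C x * (A w * B (w ⊕ x))))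
    ≡⟨ 𝔼-swap n _ ⟩
  𝔼 n (λ w → 𝔼 n (λ x → C x * (A w * B (w ⊕ x))))
    ≡⟨ 𝔼-cong n (λ w → 𝔼-cong n (λ x → trans (cong (λ v → C x * (A w * B v)) (⊕-comm w x))
         (solve 3 (λ c a b → c :* (a :* b) := a :* (c :* b)) refl (C x) (A w) (B (x ⊕ w))))) ⟩
  𝔼 n (λ w → 𝔼 n (λ x → A w * (C x * B (x ⊕ w))))
    ≡⟨ 𝔼-cong n (λ w → 𝔼-*ˡ n (A w) _) ⟩
  𝔼 n (λ w → A w * 𝔼 n (λ x → C x * B (x ⊕ w))) ∎
  where open ≡-Reasoning

⋆-translate : (n : ℕ) (A B : 𝔽₂^ n → ℚ) (x y : 𝔽₂^ n) →
  𝔼 n (λ w → A (x ⊕ w) * B (y ⊕ w)) ≡ (A ⋆ B) (x ⊕ y)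
⋆-translate n A B x y = begin
  𝔼 n (λ w → A (x ⊕ w) * B (y ⊕ w))
    ≡⟨ 𝔼-cong n (λ w → cong (λ v → A (x ⊕ w) * B v) (sym (difference w))) ⟩
  𝔼 n (λ w → A (x ⊕ w) * B ((x ⊕ w) ⊕ (x ⊕ y)))
    ≡⟨ 𝔼-translate n (λ w → A w * B (w ⊕ (x ⊕ y))) x ⟩
  (A ⋆ B) (x ⊕ y) ∎
  where
  open ≡-Reasoning
  difference : ∀ w → (x ⊕ w) ⊕ (x ⊕ y) ≡ y ⊕ w
  difference w = begin
    (x ⊕ w) ⊕ (x ⊕ y)  ≡⟨ cong (_⊕ (x ⊕ y)) (⊕-comm x w) ⟩
    (w ⊕ x) ⊕ (x ⊕ y)  ≡⟨ ⊕-assoc w x (x ⊕ y) ⟩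
    w ⊕ (x ⊕ (x ⊕ y))  ≡⟨ cong (w ⊕_) (⊕-cancelˡ x y) ⟩
    w ⊕ y              ≡⟨ ⊕-comm w y ⟩
    y ⊕ w              ∎

𝔼-sq-⋆ : (n : ℕ) (C B : 𝔽₂^ n → ℚ) →
  𝔼 n (λ w → sq ((C ⋆ B) w)) ≡ 𝔼 n (λ x → 𝔼 n (λ y → C x * C y * (B ⋆ B) (x ⊕ y)))
𝔼-sq-⋆ n C B = begin
  𝔼 n (λ w → (C ⋆ B) w * (C ⋆ B) w)
    ≡⟨ 𝔼-cong n (λ w → trans (sym (𝔼-*ʳ n ((C ⋆ B) w) _))
         (𝔼-cong n (λ x → sym (𝔼-*ˡ n (C x * B (x ⊕ w)) _)))) ⟩
  𝔼 n (λ w → 𝔼 n (λ x → 𝔼 n (λ y → C x * B (x ⊕ w) * (C y * B (y ⊕ w)))))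
    ≡⟨ 𝔼-swap n _ ⟩
  𝔼 n (λ x → 𝔼 n (λ w → 𝔼 n (λ y → C x * B (x ⊕ w) * (C y * B (y ⊕ w)))))
    ≡⟨ 𝔼-cong n (λ x → 𝔼-swap n _) ⟩
  𝔼 n (λ x → 𝔼 n (λ y → 𝔼 n (λ w → C x * B (x ⊕ w) * (C y * B (y ⊕ w)))))
    ≡⟨ 𝔼-cong n (λ x → 𝔼-cong n (λ y → trans
         (𝔼-cong n (λ w → solve 4 (λ c b d e → c :* b :* (d :* e) := c :* d :* (b :* e)) refl
            (C x) (B (x ⊕ w)) (C y) (B (y ⊕ w))))
         (𝔼-*ˡ n (C x * C y) _))) ⟩
  𝔼 n (λ x → 𝔼 n (λ y → C x * C y * 𝔼 n (λ w → B (x ⊕ w) * B (y ⊕ w))))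
    ≡⟨ 𝔼-cong n (λ x → 𝔼-cong n (λ y → cong (C x * C y *_) (⋆-translate n B B x y))) ⟩
  𝔼 n (λ x → 𝔼 n (λ y → C x * C y * (B ⋆ B) (x ⊕ y))) ∎
  where open ≡-Reasoning

-- Cauchy–Schwarz

sq-nonNeg : (p : ℚ) → 0ℚ ≤ sq p
sq-nonNeg p with ≤-total 0ℚ p
... | inj₁ 0≤p =
  nonNegative⁻¹ _ {{nonNeg*nonNeg⇒nonNeg p {{nonNegative 0≤p}} p {{nonNegative 0≤p}}}}
-- Despite its name, nonPos*nonPos⇒nonPos concludes NonNegative (p * q).
... | inj₂ p≤0 =
  nonNegative⁻¹ _ {{nonPos*nonPos⇒nonPos p {{nonPositive p≤0}} p {{nonPositive p≤0}}}}

sq-mono-≤ : {p q : ℚ} → 0ℚ ≤ p → p ≤ q → sq p ≤ sq q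
sq-mono-≤ {p} {q} 0≤p p≤q = ≤-trans (*-monoˡ-≤-nonNeg p {{nonNegative 0≤p}} p≤q)
                                    (*-monoʳ-≤-nonNeg q {{nonNegative (≤-trans 0≤p p≤q)}} p≤q)

*-pos : {p q : ℚ} → 0ℚ < p → 0ℚ < q → 0ℚ < p * q
*-pos {p} {q} 0<p 0<q = positive⁻¹ _ {{pos*pos⇒pos p {{positive 0<p}} q {{positive 0<q}}}}

pow-pos : {p : ℚ} → 0ℚ < p → (k : ℕ) → 0ℚ < pow p k
pow-pos 0<p zero    = positive⁻¹ 1ℚ
pow-pos 0<p (suc k) = *-pos 0<p (pow-pos 0<p k)

cauchy-schwarz-±1 : (n : ℕ) (ψ H : 𝔽₂^ n → ℚ) → (∀ w → sq (ψ w) ≡ 1ℚ) →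
  sq (𝔼 n (λ w → ψ w * H w)) ≤ 𝔼 n (λ w → sq (H w))
cauchy-schwarz-±1 n ψ H ψ²≡1 = begin
  sq c                         ≡⟨ sym (+-identityˡ (sq c)) ⟩
  0ℚ + sq c                    ≤⟨ +-monoˡ-≤ (sq c) (𝔼-nonNeg n (λ w → sq-nonNeg (D w))) ⟩
  𝔼 n (λ w → sq (D w)) + sq c  ≡⟨ sym 𝔼-sq-H ⟩
  𝔼 n (λ w → sq (H w))         ∎
  where
  open ≤-Reasoning
  c : ℚ
  c = 𝔼 n (λ w → ψ w * H w)
  D : 𝔽₂^ n → ℚ
  D w = H w - c * ψ w
  expand : ∀ w → sq (H w) ≡ sq (D w) + (c + c) * (ψ w * H w) + - sq c
  expand w = begin-equality
    sq (H w)
      ≡⟨ solve 3 (λ h c p → h :* h := (h :- c :* p) :* (h :- c :* p) :+ (c :+ c) :* (p :* h)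
                                       :+ (:- (c :* c)) :* (p :* p)) refl (H w) c (ψ w) ⟩
    sq (D w) + (c + c) * (ψ w * H w) + (- sq c) * sq (ψ w)
      ≡⟨ cong (λ t → sq (D w) + (c + c) * (ψ w * H w) + t)
              (trans (cong ((- sq c) *_) (ψ²≡1 w)) (*-identityʳ _)) ⟩
    sq (D w) + (c + c) * (ψ w * H w) + - sq c ∎
  𝔼-sq-H : 𝔼 n (λ w → sq (H w)) ≡ 𝔼 n (λ w → sq (D w)) + sq c
  𝔼-sq-H = begin-equality
    𝔼 n (λ w → sq (H w))
      ≡⟨ 𝔼-cong n expand ⟩
    𝔼 n (λ w → sq (D w) + (c + c) * (ψ w * H w) + - sq c)
      ≡⟨ 𝔼-+ n _ (λ _ → - sq c) ⟩
    𝔼 n (λ w → sq (D w) + (c + c) * (ψ w * H w)) + 𝔼 n (λ _ → - sq c)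
      ≡⟨ cong₂ _+_ (trans (𝔼-+ n _ _) (cong (𝔼 n (λ w → sq (D w)) +_) (𝔼-*ˡ n (c + c) _)))
                   (𝔼-const n (- sq c)) ⟩
    𝔼 n (λ w → sq (D w)) + (c + c) * c + - sq c
      ≡⟨ solve 2 (λ e c → e :+ (c :+ c) :* c :+ (:- (c :* c)) := e :+ c :* c)
                 refl (𝔼 n (λ w → sq (D w))) c ⟩
    𝔼 n (λ w → sq (D w)) + sq c ∎

sq-𝔼≤𝔼-sq : (n : ℕ) (h : 𝔽₂^ n → ℚ) → sq (𝔼 n h) ≤ 𝔼 n (λ x → sq (h x))
sq-𝔼≤𝔼-sq n h =
  subst (λ e → sq e ≤ 𝔼 n (λ x → sq (h x))) (𝔼-cong n (λ x → *-identityˡ (h x)))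
        (cauchy-schwarz-±1 n (λ _ → 1ℚ) h (λ _ → refl))

-- Gowers norms

U2⁴ : (n : ℕ) → (𝔽₂^ n → ℚ) → ℚ
U2⁴ n g = 𝔼 n λ x → 𝔼 n λ y₁ → 𝔼 n λ y₂ → g x * g (x ⊕ y₁) * g (x ⊕ y₂) * g ((x ⊕ y₁) ⊕ y₂)

⋆-triple : (n : ℕ) → (𝔽₂^ n → ℚ) → ℚ
⋆-triple n g = 𝔼 n λ x → 𝔼 n λ y → (g ⋆ g) x * (g ⋆ g) y * (g ⋆ g) (x ⊕ y)

U2⁴≡𝔼-sq-⋆ : (n : ℕ) (g : 𝔽₂^ n → ℚ) → U2⁴ n g ≡ 𝔼 n (λ y → sq ((g ⋆ g) y))
U2⁴≡𝔼-sq-⋆ n g = begin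
  U2⁴ n g
    ≡⟨ 𝔼-swap n _ ⟩
  𝔼 n (λ y₁ → 𝔼 n (λ x → 𝔼 n (λ y₂ → g x * g (x ⊕ y₁) * g (x ⊕ y₂) * g ((x ⊕ y₁) ⊕ y₂))))
    ≡⟨ 𝔼-cong n (λ y₁ → 𝔼-cong n (λ x → trans (𝔼-cong n (λ y₂ →
         trans (cong (λ v → g x * g (x ⊕ y₁) * g (x ⊕ y₂) * g v) (⊕-swapʳ x y₁ y₂))
               (*-assoc (g x * g (x ⊕ y₁)) (g (x ⊕ y₂)) _)))
         (𝔼-*ˡ n (g x * g (x ⊕ y₁)) _))) ⟩
  𝔼 n (λ y₁ → 𝔼 n (λ x → g x * g (x ⊕ y₁) * 𝔼 n (λ y₂ → g (x ⊕ y₂) * g ((x ⊕ y₂) ⊕ y₁))))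
    ≡⟨ 𝔼-cong n (λ y₁ → 𝔼-cong n (λ x →
         cong (g x * g (x ⊕ y₁) *_) (𝔼-translate n (λ u → g u * g (u ⊕ y₁)) x))) ⟩
  𝔼 n (λ y₁ → 𝔼 n (λ x → g x * g (x ⊕ y₁) * (g ⋆ g) y₁))
    ≡⟨ 𝔼-cong n (λ y₁ → 𝔼-*ʳ n ((g ⋆ g) y₁) _) ⟩
  𝔼 n (λ y₁ → sq ((g ⋆ g) y₁)) ∎
  where open ≡-Reasoning

U3⁸≡𝔼-U2⁴ : (n : ℕ) (f : 𝔽₂^ n → ℚ) → U3⁸ n f ≡ 𝔼 n (λ y → U2⁴ n (deriv f y))
U3⁸≡𝔼-U2⁴ n f = trans (𝔼-swap n _)
  (𝔼-cong n (λ y₁ → 𝔼-cong n (λ x → 𝔼-cong n (λ y₂ → 𝔼-cong n (λ y₃ → regroup x y₁ y₂ y₃)))))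
  where
  regroup : ∀ x y₁ y₂ y₃ →
    f x * f (x ⊕ y₁) * f (x ⊕ y₂) * f (x ⊕ y₃)
    * f ((x ⊕ y₁) ⊕ y₂) * f ((x ⊕ y₁) ⊕ y₃) * f ((x ⊕ y₂) ⊕ y₃)
    * f (((x ⊕ y₁) ⊕ y₂) ⊕ y₃)
    ≡ deriv f y₁ x * deriv f y₁ (x ⊕ y₂) * deriv f y₁ (x ⊕ y₃) * deriv f y₁ ((x ⊕ y₂) ⊕ y₃)
  regroup x y₁ y₂ y₃
    rewrite ⊕-swapʳ x y₁ y₂ | ⊕-swapʳ x y₁ y₃ | ⊕-swapʳ (x ⊕ y₂) y₁ y₃ =
    solve 8 (λ a b c d e f g h → a :* b :* c :* d :* e :* f :* g :* h
                              := a :* b :* (c :* e) :* (d :* f) :* (g :* h)) refl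
      (f x) (f (x ⊕ y₁)) (f (x ⊕ y₂)) (f (x ⊕ y₃))
      (f ((x ⊕ y₂) ⊕ y₁)) (f ((x ⊕ y₃) ⊕ y₁)) (f ((x ⊕ y₂) ⊕ y₃)) (f (((x ⊕ y₂) ⊕ y₃) ⊕ y₁))

⋆-deriv-swap : (n : ℕ) (f : 𝔽₂^ n → ℚ) (x z : 𝔽₂^ n) →
  (deriv f x ⋆ deriv f x) z ≡ (deriv f z ⋆ deriv f z) x
⋆-deriv-swap n f x z = 𝔼-cong n (λ w →
  trans (cong (λ v → f w * f (w ⊕ x) * (f (w ⊕ z) * f v)) (⊕-swapʳ w z x))
        (solve 4 (λ a b c d → a :* b :* (c :* d) := a :* c :* (b :* d)) refl
           (f w) (f (w ⊕ x)) (f (w ⊕ z)) (f ((w ⊕ x) ⊕ z))))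

Q≡𝔼-⋆-triple : (n : ℕ) (f : 𝔽₂^ n → ℚ) → Q n f ≡ 𝔼 n (λ z → ⋆-triple n (deriv f z))
Q≡𝔼-⋆-triple n f = begin
  Q n f
    ≡⟨ 𝔼-cong n (λ x → 𝔼-cong n (λ y → trans
         (Σ𝔽-cong n (λ α → Σ𝔽-cong n (λ β →
            cong₂ _*_ (cong₂ _*_ (sq-hat (deriv f x) α) (sq-hat (deriv f y) β))
                      (sq-hat (deriv f (x ⊕ y)) (α ⊕ β)))))
         (fourier-triple-product n (G x) (G y) (G (x ⊕ y))))) ⟩
  𝔼 n (λ x → 𝔼 n (λ y → 𝔼 n (λ z → G x z * G y z * G (x ⊕ y) z)))
    ≡⟨ 𝔼-cong n (λ x → 𝔼-swap n _) ⟩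
  𝔼 n (λ x → 𝔼 n (λ z → 𝔼 n (λ y → G x z * G y z * G (x ⊕ y) z)))
    ≡⟨ 𝔼-swap n _ ⟩
  𝔼 n (λ z → 𝔼 n (λ x → 𝔼 n (λ y → G x z * G y z * G (x ⊕ y) z)))
    ≡⟨ 𝔼-cong n (λ z → 𝔼-cong n (λ x → 𝔼-cong n (λ y →
         cong₂ _*_ (cong₂ _*_ (⋆-deriv-swap n f x z) (⋆-deriv-swap n f y z))
                   (⋆-deriv-swap n f (x ⊕ y) z)))) ⟩
  𝔼 n (λ z → ⋆-triple n (deriv f z)) ∎
  where
  open ≡-Reasoning
  G : 𝔽₂^ n → 𝔽₂^ n → ℚ
  G x = deriv f x ⋆ deriv f x
  sq-hat : (h : 𝔽₂^ n → ℚ) (α : 𝔽₂^ n) → sq (hat n h α) ≡ hat n (h ⋆ h) α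
  sq-hat h α = sym (hat-⋆ n h h α)

sq-U2⁴≤⋆-triple : (n : ℕ) (g : 𝔽₂^ n → ℚ) → (∀ w → sq (g w) ≡ 1ℚ) →
  sq (U2⁴ n g) ≤ ⋆-triple n g
sq-U2⁴≤⋆-triple n g g²≡1 = begin
  sq (U2⁴ n g)                           ≡⟨ cong sq (U2⁴≡𝔼-sq-⋆ n g) ⟩
  sq (𝔼 n (λ x → (g ⋆ g) x * (g ⋆ g) x))  ≡⟨ cong sq (𝔼-⋆-adjoint n g g (g ⋆ g)) ⟩
  sq (𝔼 n (λ w → g w * ((g ⋆ g) ⋆ g) w))  ≤⟨ cauchy-schwarz-±1 n g ((g ⋆ g) ⋆ g) g²≡1 ⟩
  𝔼 n (λ w → sq (((g ⋆ g) ⋆ g) w))        ≡⟨ 𝔼-sq-⋆ n (g ⋆ g) g ⟩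
  ⋆-triple n g                           ∎
  where open ≤-Reasoning

IsBoolean⇒sq≡1 : {f : 𝔽₂^ n → ℚ} → IsBoolean f → ∀ x → sq (f x) ≡ 1ℚ
IsBoolean⇒sq≡1 f-bool x with f-bool x
... | inj₁ fx≡1  = cong sq fx≡1
... | inj₂ fx≡-1 = cong sq fx≡-1

deriv-sq≡1 : (f : 𝔽₂^ n → ℚ) → (∀ x → sq (f x) ≡ 1ℚ) → ∀ y x → sq (deriv f y x) ≡ 1ℚ
deriv-sq≡1 f f²≡1 y x = begin
  sq (f x * f (x ⊕ y))
    ≡⟨ solve 2 (λ a b → (a :* b) :* (a :* b) := (a :* a) :* (b :* b)) refl (f x) (f (x ⊕ y)) ⟩
  sq (f x) * sq (f (x ⊕ y))
    ≡⟨ cong₂ _*_ (f²≡1 x) (f²≡1 (x ⊕ y)) ⟩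
  1ℚ ∎
  where open ≡-Reasoning

sq-U3⁸≤Q : (n : ℕ) (f : 𝔽₂^ n → ℚ) → IsBoolean f → sq (U3⁸ n f) ≤ Q n f
sq-U3⁸≤Q n f f-bool = begin
  sq (U3⁸ n f)
    ≡⟨ cong sq (U3⁸≡𝔼-U2⁴ n f) ⟩
  sq (𝔼 n (λ y → U2⁴ n (deriv f y)))
    ≤⟨ sq-𝔼≤𝔼-sq n _ ⟩
  𝔼 n (λ y → sq (U2⁴ n (deriv f y)))
    ≤⟨ 𝔼-mono n (λ y → sq-U2⁴≤⋆-triple n (deriv f y) (f_y²≡1 y)) ⟩
  𝔼 n (λ y → ⋆-triple n (deriv f y))
    ≡⟨ sym (Q≡𝔼-⋆-triple n f) ⟩
  Q n f ∎
  where
  open ≤-Reasoning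
  f_y²≡1 : ∀ y x → sq (deriv f y x) ≡ 1ℚ
  f_y²≡1 = deriv-sq≡1 f (IsBoolean⇒sq≡1 f-bool)

corollary6p6 : (ε : ℚ) → 0ℚ < ε →
    ∃ λ (ε′ : ℚ) → 0ℚ < ε′ ×
      ((n : ℕ) (f : 𝔽₂^ n → ℚ) → IsBoolean f →
        pow ε 8 ≤ U3⁸ n f → ε′ ≤ Q n f)
corollary6p6 ε 0<ε = sq (pow ε 8) , *-pos 0<ε⁸ 0<ε⁸ , bound
  where
  0<ε⁸ : 0ℚ < pow ε 8
  0<ε⁸ = pow-pos 0<ε 8
  bound : (n : ℕ) (f : 𝔽₂^ n → ℚ) → IsBoolean f → pow ε 8 ≤ U3⁸ n f → sq (pow ε 8) ≤ Q n f
  bound n f f-bool ε⁸≤U3⁸ = ≤-trans (sq-mono-≤ (<⇒≤ 0<ε⁸) ε⁸≤U3⁸) (sq-U3⁸≤Q n f f-bool)
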